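{- Let $\mathcal{C}$ be a collection of $\mathbf{S}$-structures that is linear-diagrammatically $(n,m,\ell)$-compatible, for integers $n,m\geq0$ with $n+m>0$ and $\ell>0$. Then $\mathcal{C}$ is diagrammatically $(n,m,\ell)$-compatible.
   Context: A schema $\mathbf{S}$ is a finite set of relation symbols with positive arities. An $\mathbf{S}$-structure $I$ has a domain $\mathrm{dom}(I)$ contained in a fixed countably infinite set of constants and relations $R^I\subseteq\mathrm{dom}(I)^{\mathrm{ar}(R)}$; $\mathrm{facts}(I)$ is its set of facts, $\mathrm{adom}(I)$ the set of elements occurring in facts. $J\subseteq I$ means $\mathrm{facts}(J)\subseteq\mathrm{facts}(I)$; $J\preceq I$ means $\mathrm{dom}(J)\subseteq\mathrm{dom}(I)$ and $R^J=R^I\cap\mathrm{dom}(J)^{\mathrm{ar}(R)}$ for all $R$. Diagrams: sentences may mention constants, interpreted as themselves. For an $\mathbf{S}$-structure $I$, a finite $K\subseteq I$ with $\mathrm{dom}(K)=\mathrm{adom}(K)$, and $m\geq0$: with distinct variables $y_1,\dots,y_m$, $C_{K,m}$ is the set of conjunctions of atoms $R(\bar u)$, $R\in\mathbf{S}$, $\bar u\in(\mathrm{dom}(K)\cup\{y_1,\dots,y_m\})^{\mathrm{ar}(R)}$; $N^I_{K,m}=\{\gamma(\bar y)\in C_{K,m}:I\not\models\exists\bar y\,\gamma(\bar y)\}$. For $G\subseteq N^I_{K,m}$ with $|G|\leq\ell$, $\Delta^I_{K,G}=\bigwedge_{\alpha\in\mathrm{facts}(K)}\alpha\wedge\bigwedge_{c\neq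 d\in\mathrm{dom}(K)}\neg(c=d)\wedge\bigwedge_{\gamma\in G}\neg\exists\bar y\,\gamma(\bar y)$ is an $(m,\ell)$-diagram of $K$ relative to $I$. $\mathcal{C}$ is diagrammatically $(n,m,\ell)$-compatible with $I$ if for every $K\preceq I$ with $\mathrm{dom}(K)=\mathrm{adom}(K)$, $|\mathrm{dom}(K)|\leq n$, and every $(m,\ell)$-diagram $\Delta$ of $K$ relative to $I$, some $J\in\mathcal{C}$ satisfies $\Delta$. A structure $K$ is linear if $|\mathrm{facts}(K)|\leq1$; $\mathcal{C}$ is linear-diagrammatically $(n,m,\ell)$-compatible with $I$ if the same condition holds for every linear $K\subseteq I$ with $\mathrm{dom}(K)=\mathrm{adom}(K)$ and $|\mathrm{dom}(K)|\leq n$. $\mathcal{C}$ is (linear-)diagrammatically $(n,m,\ell)$-compatible if every $\mathbf{S}$-structure $I$ with which $\mathcal{C}$ is (linear-)diagrammatically $(n,m,\ell)$-compatible belongs to $\mathcal{C}$. -}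

module Defs where

open import Data.Nat using (ℕ; _≤_; _<_)
open import Data.Fin using (Fin)
open import Data.Vec using (Vec)
import Data.Vec as Vec
open import Data.Vec.Relation.Unary.All using () renaming (All to VAll)
import Data.Vec.Membership.Propositional as VMem
open import Data.List using (List; length)
open import Data.List.Relation.Unary.All using (All)
open import Data.List.Relation.Unary.Unique.Propositional using (Unique)
open import Data.List.Membership.Propositional using (_∈_)
open import Data.Product using (Σ; _×_; proj₁; proj₂)
open import Data.Sum using (_⊎_; inj₁; inj₂)
open import Data.Unit using (⊤)
open import Relation.Nullary using (¬_)
open import Relation.Binary.PropositionalEquality using (_≡_; _≢_)

-- Constants: the fixed countably infinite set is ℕ.

record Schema : Set where
  field
    size   : ℕ
    ar     : Fin size → ℕ
    ar-pos : ∀ R → 1 ≤ ar R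
open Schema public

module _ (S : Schema) where

  record Structure : Set₁ where
    field
      dom     : ℕ → Set
      rel     : (R : Fin (size S)) → Vec ℕ (ar S R) → Set
      rel-dom : ∀ R t → rel R t → VAll dom t
  open Structure public

  Fact : Set
  Fact = Σ (Fin (size S)) λ R → Vec ℕ (ar S R)

  IsFact : Structure → Fact → Set
  IsFact I f = rel I (proj₁ f) (proj₂ f)

  adom : Structure → ℕ → Set
  adom I c = Σ (Fin (size S)) λ R → Σ (Vec ℕ (ar S R)) λ t → rel I R t × VMem._∈_ c t

  _⊆ˢ_ : Structure → Structure → Set
  J ⊆ˢ I = ∀ R t → rel J R t → rel I R t

  _⪯_ : Structure → Structure → Set
  J ⪯ I = (∀ c → dom J c → dom I c)
        × (∀ R t → (rel J R t → rel I R t × VAll (dom J) t)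
                 × (rel I R t × VAll (dom J) t → rel J R t))

  -- dom(K) = adom(K)  (adom ⊆ dom holds automatically)
  DomIsAdom : Structure → Set
  DomIsAdom K = ∀ c → dom K c → adom K c

  DomSizeAtMost : Structure → ℕ → Set
  DomSizeAtMost K n = Σ (List ℕ) λ xs → Unique xs
                        × (∀ c → (dom K c → c ∈ xs) × (c ∈ xs → dom K c))
                        × length xs ≤ n

  Linear : Structure → Set
  Linear K = ∀ f g → IsFact K f → IsFact K g → f ≡ g

  -- terms of C_{K,m}: constants or variables y_1..y_m
  Term : ℕ → Set
  Term m = ℕ ⊎ Fin m

  Atom : ℕ → Set
  Atom m = Σ (Fin (size S)) λ R → Vec (Term m) (ar S R)

  CQ : ℕ → Set
  CQ m = List (Atom m)

  ConstIn : Structure → {m : ℕ} → Term m → Set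
  ConstIn K (inj₁ c) = dom K c
  ConstIn K (inj₂ _) = ⊤

  InC : Structure → (m : ℕ) → CQ m → Set
  InC K m γ = All (λ a → VAll (ConstIn K) (proj₂ a)) γ

  eval : {m : ℕ} → (Fin m → ℕ) → Term m → ℕ
  eval f (inj₁ c) = c
  eval f (inj₂ i) = f i

  HoldsEx : Structure → (m : ℕ) → CQ m → Set
  HoldsEx I m γ = Σ (Fin m → ℕ) λ f → (∀ i → dom I (f i))
                   × All (λ a → rel I (proj₁ a) (Vec.map (eval f) (proj₂ a))) γ

  InN : Structure → Structure → (m : ℕ) → CQ m → Set
  InN I K m γ = InC K m γ × ¬ HoldsEx I m γ

  -- G ⊆ N^I_{K,m}, |G| ≤ ℓ : G (listed) determines the (m,ℓ)-diagram Δ^I_{K,G}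
  IsDiagramSet : Structure → Structure → (m ℓ : ℕ) → List (CQ m) → Set
  IsDiagramSet I K m ℓ G = All (InN I K m) G × length G ≤ ℓ

  -- J ⊨ Δ^I_{K,G}  (the conjunction written out)
  SatDiagram : Structure → Structure → (m : ℕ) → List (CQ m) → Set
  SatDiagram J K m G = (∀ R t → rel K R t → rel J R t)
                     × (∀ c d → dom K c → dom K d → c ≢ d → ¬ (c ≡ d))
                     × All (λ γ → ¬ HoldsEx J m γ) G

  DiagCompatWith : (Structure → Set) → (n m ℓ : ℕ) → Structure → Set₁
  DiagCompatWith C n m ℓ I =
    ∀ K → K ⪯ I → DomIsAdom K → DomSizeAtMost K n →
    ∀ G → IsDiagramSet I K m ℓ G → Σ Structure λ J → C J × SatDiagram J K m G

  LinDiagCompatWith : (Structure → Set) → (n m ℓ : ℕ) → Structure → Set₁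
  LinDiagCompatWith C n m ℓ I =
    ∀ K → Linear K → K ⊆ˢ I → DomIsAdom K → DomSizeAtMost K n →
    ∀ G → IsDiagramSet I K m ℓ G → Σ Structure λ J → C J × SatDiagram J K m G

  DiagCompat : (Structure → Set) → (n m ℓ : ℕ) → Set₁
  DiagCompat C n m ℓ = ∀ I → DiagCompatWith C n m ℓ I → C I

  LinDiagCompat : (Structure → Set) → (n m ℓ : ℕ) → Set₁
  LinDiagCompat C n m ℓ = ∀ I → LinDiagCompatWith C n m ℓ I → C I

{-# OPTIONS --safe #-}
module Submission where

open import Defs
open import Data.Nat using (ℕ; _+_; _<_)
open import Data.Product using (_×_; _,_; proj₂)
open import Data.Sum using (inj₁; inj₂)
import Data.Vec.Relation.Unary.All as Vecᴬ
import Data.List.Relation.Unary.All as Listᴬ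

module _ {S : Schema} where

  restrict : Structure S → (ℕ → Set) → Structure S
  restrict I D = record
    { dom     = D
    ; rel     = λ R t → rel I R t × Vecᴬ.All D t
    ; rel-dom = λ R t → proj₂
    }

  restrict-⪯ : ∀ {I D} → (∀ c → D c → dom I c) → _⪯_ S (restrict I D) I
  restrict-⪯ D⊆I = D⊆I , λ R t → (λ r → r) , (λ r → r)

  ⊆ˢ-restrict-dom : ∀ {K I} → _⊆ˢ_ S K I → _⊆ˢ_ S K (restrict I (dom K))
  ⊆ˢ-restrict-dom {K} K⊆I R t r = K⊆I R t r , rel-dom K R t r

  DomIsAdom-⊆ˢ⇒dom⊆ : ∀ {K I} → _⊆ˢ_ S K I → DomIsAdom S K → ∀ c → dom K c → dom I c
  DomIsAdom-⊆ˢ⇒dom⊆ {I = I} K⊆I K-adom c c∈K =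
    let R , t , r , c∈t = K-adom c c∈K in Vecᴬ.lookup (rel-dom I R t (K⊆I R t r)) c∈t

  DomIsAdom-⊆ˢ : ∀ {K K'} → _⊆ˢ_ S K K' → (∀ c → dom K' c → dom K c) →
                 DomIsAdom S K → DomIsAdom S K'
  DomIsAdom-⊆ˢ K⊆K' domK'⊆K K-adom c c∈K' =
    let R , t , r , c∈t = K-adom c (domK'⊆K c c∈K') in R , t , K⊆K' R t r , c∈t

  ConstIn-mono : ∀ {K K' k} → (∀ c → dom K c → dom K' c) →
                 (u : Term S k) → ConstIn S K u → ConstIn S K' u
  ConstIn-mono domK⊆K' (inj₁ c) = domK⊆K' c
  ConstIn-mono domK⊆K' (inj₂ _) = _

  IsDiagramSet-mono : ∀ {I K K' k ℓ G} → (∀ c → dom K c → dom K' c) →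
                      IsDiagramSet S I K k ℓ G → IsDiagramSet S I K' k ℓ G
  IsDiagramSet-mono {K = K} {K'} domK⊆K' (G⊆N , |G|≤ℓ) =
    Listᴬ.map (λ (γ∈C , γ-fails) → Listᴬ.map (Vecᴬ.map (λ {u} → ConstIn-mono {K} {K'} domK⊆K' u)) γ∈C
                                   , γ-fails)
              G⊆N
    , |G|≤ℓ

  SatDiagram-antitone : ∀ {J K K' k G} → _⊆ˢ_ S K K' → (∀ c → dom K c → dom K' c) →
                        SatDiagram S J K' k G → SatDiagram S J K k G
  SatDiagram-antitone K⊆K' domK⊆K' (facts , distinct , negatives) =
    (λ R t r → facts R t (K⊆K' R t r))
    , (λ c d c∈K d∈K → distinct c d (domK⊆K' c c∈K) (domK⊆K' d d∈K))
    , negatives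

  DiagCompatWith⇒LinDiagCompatWith : ∀ {C n k ℓ I} →
    DiagCompatWith S C n k ℓ I → LinDiagCompatWith S C n k ℓ I
  DiagCompatWith⇒LinDiagCompatWith {k = k} {I = I} compat K _ K⊆I K-adom |K|≤n G G-diag =
    let J , J∈C , J⊨Δ = compat K' (restrict-⪯ {I} (DomIsAdom-⊆ˢ⇒dom⊆ {K} {I} K⊆I K-adom))
                                  (DomIsAdom-⊆ˢ {K} {K'} K⊆K' (λ _ c → c) K-adom)
                                  |K|≤n G (IsDiagramSet-mono {I} {K} (λ _ c → c) G-diag)
    in J , J∈C , SatDiagram-antitone {J} {K} {K'} {k} K⊆K' (λ _ c → c) J⊨Δ
    where
    K' : Structure S
    K' = restrict I (dom K)
    K⊆K' : _⊆ˢ_ S K K'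
    K⊆K' = ⊆ˢ-restrict-dom {K} {I} K⊆I

lemma6 : (S : Schema) (C : Structure S → Set) (n m ℓ : ℕ) →
         0 < n + m → 0 < ℓ →
         LinDiagCompat S C n m ℓ → DiagCompat S C n m ℓ
lemma6 S C n m ℓ _ _ lin-compat I compat =
  lin-compat I (DiagCompatWith⇒LinDiagCompatWith {C = C} {n} {m} {ℓ} {I} compat)
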